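{- For $n\geq 0$ let $\mu_n\in\{l,r\}^*$ be the word recording, in order, the directions of the moves of disk $1$ during the $1$-Fibonacci moves of the unique optimal solution of the Tower of Hanoi-Fibonacci with $n$ disks from $(\Delta_n,\varnothing,\varnothing)$ to $(\varnothing,\varnothing,\Delta_n)$. Then $\mu_0$ is the empty word, $\mu_1=l$, and for every $n\geq 2$, $\mu_n=(\mu_{n-1}\mu_{n-2})^*$; moreover for every $n\geq 4$, $\mu_n=\mu_{n-2}\mu_{n-3}\mu_{n-3}\mu_{n-4}$. Furthermore, for every $n\geq 0$, \[|\mu_{3n}|_r=|\mu_{3n}|_l,\qquad |\mu_{3n+1}|_l-|\mu_{3n+1}|_r=1,\qquad |\mu_{3n+2}|_r-|\mu_{3n+2}|_l=1.\]
   Context: Disks $1,\dots,n$, $\Delta_k=\{1,\dots,k\}$ ($\varnothing$ for $k<1$). A state is an ordered triple $(A,B,C)$ (pegs $A,B,C$) of disjoint sets with union $\Delta_n$, each peg stacked in decreasing order (top = minimum). For $k\in\Delta_n$, a $k$-Fibonacci move is defined when two distinct pegs $X,Y$ satisfy $X=k\tilde X$, $Y=\Delta_{k-1}\tilde Y$ (all disks of $\tilde X,\tilde Y$ larger than $k$) and the third peg $Z$ contains only disks larger than $k$; it yields $\tilde{X}\sqcup \Delta_{k-2}\tilde{Y}\sqcup (k-1)kZ$ (disks $k-1,k$ put simultaneously onto $Z$). A $1$-Fibonacci move just moves disk $1$ to another peg. The Tower of Hanoi-Fibonacci allows only Fibonacci moves; its minimal solution is unique. Disk $1$ moves to the right ($r$)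 if it goes $A\to B$, $B\to C$ or $C\to A$, and to the left ($l$) if it goes $A\to C$, $C\to B$ or $B\to A$. For a word $\mu$ over $\{l,r\}$, $\mu^*$ is obtained by exchanging $l$ and $r$, and $|\mu|_d$ is the number of occurrences of the letter $d$. -}

module Defs where

open import Data.Nat using (ℕ; zero; suc; _+_; _≤_; _<_)
open import Data.Fin using (Fin; toℕ)
open import Data.Vec using (Vec; lookup; replicate; _[_]≔_)
open import Data.List using (List; []; _∷_; _++_; map)
open import Relation.Binary.PropositionalEquality using (_≡_; _≢_)
open import Data.Sum using (_⊎_)

data Peg : Set where
  A B C : Peg

-- A state with n disks: for each disk, the peg it lies on.
-- Disk with index i : Fin n is the disk labelled toℕ i + 1.
-- On each peg the disks are stacked in decreasing order, so the
-- assignment determines the ordered triple (A,B,C) of stacks.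
State : ℕ → Set
State n = Vec Peg n

start : (n : ℕ) → State n
start n = replicate n A

goal : (n : ℕ) → State n
goal n = replicate n C

data Dir : Set where
  l r : Dir

dir : Peg → Peg → Dir
dir A B = r
dir B C = r
dir C A = r
dir _ _ = l

-- Fibonacci moves.  fib1 is a 1-Fibonacci move (disk 1 moved to peg q);
-- fibK is a k-Fibonacci move for k = toℕ k + 1 ≥ 2, with k' the disk k-1.
data Move {n : ℕ} (s : State n) : State n → Set where
  fib1 : (i : Fin n) → toℕ i ≡ 0 → (q : Peg) → q ≢ lookup s i →
         Move s (s [ i ]≔ q)
  fibK : (k k' : Fin n) → suc (toℕ k') ≡ toℕ k →
         (X Y Z : Peg) → X ≢ Y → Z ≢ X → Z ≢ Y →
         lookup s k ≡ X →
         (∀ j → lookup s j ≡ X → toℕ k ≤ toℕ j) →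
         (∀ j → toℕ j < toℕ k → lookup s j ≡ Y) →
         (∀ j → lookup s j ≡ Y → toℕ j < toℕ k ⊎ toℕ k < toℕ j) →
         (∀ j → lookup s j ≡ Z → toℕ k < toℕ j) →
         Move s ((s [ k ]≔ Z) [ k' ]≔ Z)

data Path {n : ℕ} : State n → State n → Set where
  done : ∀ {s} → Path s s
  step : ∀ {s t u} → Move s t → Path t u → Path s u

length : ∀ {n} {s t : State n} → Path s t → ℕ
length done = 0
length (step _ p) = suc (length p)

moveWord : ∀ {n} {s t : State n} → Move s t → List Dir
moveWord {s = s} (fib1 i _ q _) = dir (lookup s i) q ∷ []
moveWord (fibK _ _ _ _ _ _ _ _ _ _ _ _ _ _) = []

word : ∀ {n} {s t : State n} → Path s t → List Dir
word done = []
word (step m p) = moveWord m ++ word p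

Optimal : ∀ {n} → Path (start n) (goal n) → Set
Optimal {n} p = ∀ (q : Path (start n) (goal n)) → length p ≤ length q

swapDir : Dir → Dir
swapDir l = r
swapDir r = l

star : List Dir → List Dir
star = map swapDir

count : Dir → List Dir → ℕ
count d [] = 0
count l (l ∷ xs) = suc (count l xs)
count r (r ∷ xs) = suc (count r xs)
count l (r ∷ xs) = count l xs
count r (l ∷ xs) = count r xs

-- The optimal transfer of m + 2 disks from Y to Q moves m + 1 disks to the third peg R, makes the
-- (m + 2)-Fibonacci move putting disks m + 1 and m + 2 on Q, and moves the m disks from R to Q.
-- Since Y → R and R → Q both have the direction opposite to Y → Q, the words obey
-- μ (2 + n) = (μ (1 + n) μ n)*, and the letter counts follow from this recursion.
-- Optimality and uniqueness of the word rest on a potential on configurations that drops by at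
-- most one per move and equals minMoves m on a tower of m disks away from the target. Cutting an
-- optimal transfer at the first move of its largest disk, these lower bounds rule out every
-- alternative to the decomposition above, whose two parts are then optimal in turn.
module Submission where

open import Defs
open import Data.Nat using (ℕ; zero; suc; _+_; _*_; _∸_; _≤_; _<_; z≤n; s≤s; _⊓_)
open import Data.Nat.Properties
open import Data.Nat.Induction using (<-rec)
open import Data.Fin using (Fin; toℕ) renaming (zero to fzero; suc to fsuc)
open import Data.Fin.Properties using (toℕ-injective)
open import Data.Vec using (lookup; toList; _[_]≔_) renaming (_∷_ to _∷ᵥ_)
open import Data.Vec.Properties using (toList-replicate; toList-injective; cast-is-id)
open import Data.List using (List; []; _∷_; _++_; replicate)
import Data.List as List
open import Data.List.Properties
  using (map-++; ++-assoc; ++-identityʳ; length-replicate; ∷-injective; ∷-injectiveˡ; ∷-injectiveʳ)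
open import Data.Product using (Σ; Σ-syntax; _×_; _,_; proj₁; proj₂)
open import Data.Sum using (_⊎_; inj₁; inj₂)
open import Data.Empty using (⊥-elim)
open import Relation.Nullary using (Dec; yes; no)
open import Relation.Binary.Definitions using (tri<; tri≈; tri>)
open import Relation.Binary.PropositionalEquality
open import Function using (_∘_)

-- The words μ n and their letter counts

μ : ℕ → List Dir
μ zero = []
μ (suc zero) = l ∷ []
μ (suc (suc n)) = star (μ (suc n) ++ μ n)

swapDir-involutive : ∀ d → swapDir (swapDir d) ≡ d
swapDir-involutive l = refl
swapDir-involutive r = refl

star-involutive : ∀ ws → star (star ws) ≡ ws
star-involutive [] = refl
star-involutive (d ∷ ws) = cong₂ _∷_ (swapDir-involutive d) (star-involutive ws)

star-++ : ∀ us vs → star (us ++ vs) ≡ star us ++ star vs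
star-++ = map-++ swapDir

μ-four-blocks : ∀ n → μ (4 + n) ≡ μ (2 + n) ++ μ (1 + n) ++ μ (1 + n) ++ μ n
μ-four-blocks n = begin
  star (star (μ (2 + n) ++ μ (1 + n)) ++ star (μ (1 + n) ++ μ n))
    ≡⟨ star-++ (star (μ (2 + n) ++ μ (1 + n))) _ ⟩
  star (star (μ (2 + n) ++ μ (1 + n))) ++ star (star (μ (1 + n) ++ μ n))
    ≡⟨ cong₂ _++_ (star-involutive (μ (2 + n) ++ μ (1 + n))) (star-involutive (μ (1 + n) ++ μ n)) ⟩
  (μ (2 + n) ++ μ (1 + n)) ++ μ (1 + n) ++ μ n
    ≡⟨ ++-assoc (μ (2 + n)) _ _ ⟩
  μ (2 + n) ++ μ (1 + n) ++ μ (1 + n) ++ μ n ∎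
  where open ≡-Reasoning

count-++ : ∀ d us vs → count d (us ++ vs) ≡ count d us + count d vs
count-++ d [] vs = refl
count-++ l (l ∷ us) vs = cong suc (count-++ l us vs)
count-++ l (r ∷ us) vs = count-++ l us vs
count-++ r (l ∷ us) vs = count-++ r us vs
count-++ r (r ∷ us) vs = cong suc (count-++ r us vs)

count-star : ∀ d ws → count d (star ws) ≡ count (swapDir d) ws
count-star d [] = refl
count-star l (l ∷ ws) = count-star l ws
count-star l (r ∷ ws) = cong suc (count-star l ws)
count-star r (l ∷ ws) = cong suc (count-star r ws)
count-star r (r ∷ ws) = count-star r ws

#l #r : ℕ → ℕ
#l n = count l (μ n)
#r n = count r (μ n)

#l-step : ∀ n → #l (2 + n) ≡ #r (1 + n) + #r n
#l-step n = trans (count-star l (μ (1 + n) ++ μ n)) (count-++ r (μ (1 + n)) (μ n))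

#r-step : ∀ n → #r (2 + n) ≡ #l (1 + n) + #l n
#r-step n = trans (count-star r (μ (1 + n) ++ μ n)) (count-++ l (μ (1 + n)) (μ n))

Balance : ℕ → Set
Balance k = (#r k ≡ #l k) × (#l (1 + k) ≡ 1 + #r (1 + k)) × (#r (2 + k) ≡ 1 + #l (2 + k))

balance-step : ∀ k → Balance k → Balance (3 + k)
balance-step k (_ , left₁ , right₂) = balanced₃ , left₄ , right₅
  where
  open ≡-Reasoning
  balanced₃ : #r (3 + k) ≡ #l (3 + k)
  balanced₃ = begin
    #r (3 + k)                  ≡⟨ #r-step (1 + k) ⟩
    #l (2 + k) + #l (1 + k)     ≡⟨ cong (#l (2 + k) +_) left₁ ⟩
    #l (2 + k) + suc (#r (1 + k)) ≡⟨ +-suc (#l (2 + k)) _ ⟩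
    suc (#l (2 + k)) + #r (1 + k) ≡⟨ cong (_+ #r (1 + k)) right₂ ⟨
    #r (2 + k) + #r (1 + k)     ≡⟨ #l-step (1 + k) ⟨
    #l (3 + k)                  ∎
  left₄ : #l (4 + k) ≡ 1 + #r (4 + k)
  left₄ = begin
    #l (4 + k)                    ≡⟨ #l-step (2 + k) ⟩
    #r (3 + k) + #r (2 + k)       ≡⟨ cong₂ _+_ balanced₃ right₂ ⟩
    #l (3 + k) + suc (#l (2 + k)) ≡⟨ +-suc (#l (3 + k)) _ ⟩
    suc (#l (3 + k) + #l (2 + k)) ≡⟨ cong suc (#r-step (2 + k)) ⟨
    suc (#r (4 + k))              ∎
  right₅ : #r (5 + k) ≡ 1 + #l (5 + k)
  right₅ = begin
    #r (5 + k)                    ≡⟨ #r-step (3 + k) ⟩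
    #l (4 + k) + #l (3 + k)       ≡⟨ cong₂ _+_ left₄ (sym balanced₃) ⟩
    suc (#r (4 + k) + #r (3 + k)) ≡⟨ cong suc (#l-step (3 + k)) ⟨
    suc (#l (5 + k))              ∎

balance : ∀ n → Balance (3 * n)
balance zero = refl , refl , refl
balance (suc n) = subst Balance (sym (*-suc 3 n)) (balance-step (3 * n) (balance n))

count-balance : ∀ n →
  count r (μ (3 * n)) ≡ count l (μ (3 * n))
  × count l (μ (3 * n + 1)) ≡ 1 + count r (μ (3 * n + 1))
  × count r (μ (3 * n + 2)) ≡ 1 + count l (μ (3 * n + 2))
count-balance n rewrite +-comm (3 * n) 1 | +-comm (3 * n) 2 = balance n

_≟ₚ_ : (X Y : Peg) → Dec (X ≡ Y)
A ≟ₚ A = yes refl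
B ≟ₚ B = yes refl
C ≟ₚ C = yes refl
A ≟ₚ B = no λ ()
A ≟ₚ C = no λ ()
B ≟ₚ A = no λ ()
B ≟ₚ C = no λ ()
C ≟ₚ A = no λ ()
C ≟ₚ B = no λ ()

-- The value on equal pegs is chosen so that third-≢ˡ and third-≢ʳ hold without hypothesis.
third : Peg → Peg → Peg
third A B = C
third B A = C
third A C = B
third C A = B
third B C = A
third C B = A
third A A = B
third B B = C
third C C = A

third-≢ˡ : ∀ X Y → third X Y ≢ X
third-≢ˡ A A ()
third-≢ˡ A B ()
third-≢ˡ A C ()
third-≢ˡ B A ()
third-≢ˡ B B ()
third-≢ˡ B C ()
third-≢ˡ C A ()
third-≢ˡ C B ()
third-≢ˡ C C ()

third-≢ʳ : ∀ X Y → third X Y ≢ Y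
third-≢ʳ A A ()
third-≢ʳ A B ()
third-≢ʳ A C ()
third-≢ʳ B A ()
third-≢ʳ B B ()
third-≢ʳ B C ()
third-≢ʳ C A ()
third-≢ʳ C B ()
third-≢ʳ C C ()

peg-trichotomy : ∀ {X Y} → X ≢ Y → ∀ P → P ≡ X ⊎ P ≡ Y ⊎ P ≡ third X Y
peg-trichotomy {A} {A} X≢Y _ = ⊥-elim (X≢Y refl)
peg-trichotomy {B} {B} X≢Y _ = ⊥-elim (X≢Y refl)
peg-trichotomy {C} {C} X≢Y _ = ⊥-elim (X≢Y refl)
peg-trichotomy {A} {B} _ A = inj₁ refl
peg-trichotomy {A} {B} _ B = inj₂ (inj₁ refl)
peg-trichotomy {A} {B} _ C = inj₂ (inj₂ refl)
peg-trichotomy {A} {C} _ A = inj₁ refl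
peg-trichotomy {A} {C} _ B = inj₂ (inj₂ refl)
peg-trichotomy {A} {C} _ C = inj₂ (inj₁ refl)
peg-trichotomy {B} {A} _ A = inj₂ (inj₁ refl)
peg-trichotomy {B} {A} _ B = inj₁ refl
peg-trichotomy {B} {A} _ C = inj₂ (inj₂ refl)
peg-trichotomy {B} {C} _ A = inj₂ (inj₂ refl)
peg-trichotomy {B} {C} _ B = inj₁ refl
peg-trichotomy {B} {C} _ C = inj₂ (inj₁ refl)
peg-trichotomy {C} {A} _ A = inj₂ (inj₁ refl)
peg-trichotomy {C} {A} _ B = inj₂ (inj₂ refl)
peg-trichotomy {C} {A} _ C = inj₁ refl
peg-trichotomy {C} {B} _ A = inj₂ (inj₂ refl)
peg-trichotomy {C} {B} _ B = inj₂ (inj₁ refl)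
peg-trichotomy {C} {B} _ C = inj₁ refl

third-unique : ∀ {X Y Z} → X ≢ Y → Z ≢ X → Z ≢ Y → Z ≡ third X Y
third-unique {X} {Y} {Z} X≢Y Z≢X Z≢Y with peg-trichotomy X≢Y Z
... | inj₁ Z≡X = ⊥-elim (Z≢X Z≡X)
... | inj₂ (inj₁ Z≡Y) = ⊥-elim (Z≢Y Z≡Y)
... | inj₂ (inj₂ Z≡third) = Z≡third

third-third : ∀ {X Y} → X ≢ Y → third X (third X Y) ≡ Y
third-third {X} {Y} X≢Y =
  sym (third-unique (≢-sym (third-≢ˡ X Y)) (≢-sym X≢Y) (≢-sym (third-≢ʳ X Y)))

dir-via-third : ∀ {Y Q} → Y ≢ Q →
  dir Y (third Y Q) ≡ swapDir (dir Y Q) × dir (third Y Q) Q ≡ swapDir (dir Y Q)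
dir-via-third {A} {B} _ = refl , refl
dir-via-third {A} {C} _ = refl , refl
dir-via-third {B} {A} _ = refl , refl
dir-via-third {B} {C} _ = refl , refl
dir-via-third {C} {A} _ = refl , refl
dir-via-third {C} {B} _ = refl , refl
dir-via-third {A} {A} Y≢Q = ⊥-elim (Y≢Q refl)
dir-via-third {B} {B} Y≢Q = ⊥-elim (Y≢Q refl)
dir-via-third {C} {C} Y≢Q = ⊥-elim (Y≢Q refl)

orient : Dir → List Dir → List Dir
orient l ws = ws
orient r ws = star ws

-- μ m is the word of the transfer A → C, of direction l; transfers of direction r mirror it.
towerWord : Peg → Peg → ℕ → List Dir
towerWord Y Q m = orient (dir Y Q) (μ m)

orient-[] : ∀ d → orient d [] ≡ []
orient-[] l = refl
orient-[] r = refl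

orient-[l] : ∀ d → orient d (l ∷ []) ≡ d ∷ []
orient-[l] l = refl
orient-[l] r = refl

orient-μ-suc² : ∀ d i → orient (swapDir d) (μ (1 + i)) ++ orient (swapDir d) (μ i) ≡ orient d (μ (2 + i))
orient-μ-suc² l i = sym (star-++ (μ (1 + i)) (μ i))
orient-μ-suc² r i = sym (star-involutive (μ (1 + i) ++ μ i))

towerWord-suc² : ∀ {Y Q} i → Y ≢ Q →
  towerWord Y (third Y Q) (1 + i) ++ towerWord (third Y Q) Q i ≡ towerWord Y Q (2 + i)
towerWord-suc² {Y} {Q} i Y≢Q with dir-via-third Y≢Q
... | first , second rewrite first | second = orient-μ-suc² (dir Y Q) i

fib : ℕ → ℕ
fib zero = 0
fib (suc zero) = 1
fib (suc (suc n)) = fib (suc n) + fib n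

minMoves : ℕ → ℕ
minMoves zero = 0
minMoves (suc zero) = 1
minMoves (suc (suc n)) = minMoves (suc n) + suc (minMoves n)

minMoves-suc : ∀ m → minMoves (suc m) ≡ minMoves m + suc (minMoves (m ∸ 1))
minMoves-suc zero = refl
minMoves-suc (suc m) = refl

suc-minMoves : ∀ n → suc (minMoves n) ≡ fib (2 + n)
suc-minMoves zero = refl
suc-minMoves (suc zero) = refl
suc-minMoves (suc (suc n)) = begin
  suc (minMoves (1 + n) + suc (minMoves n)) ≡⟨ cong suc (+-comm (minMoves (1 + n)) _) ⟩
  suc (suc (minMoves n) + minMoves (1 + n)) ≡⟨ +-suc (suc (minMoves n)) _ ⟨
  suc (minMoves n) + suc (minMoves (1 + n)) ≡⟨ cong₂ _+_ (suc-minMoves n) (suc-minMoves (suc n)) ⟩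
  fib (2 + n) + fib (3 + n)                 ≡⟨ +-comm (fib (2 + n)) _ ⟩
  fib (4 + n)                               ∎
  where open ≡-Reasoning

fib-≤-suc : ∀ n → fib n ≤ fib (suc n)
fib-≤-suc zero = z≤n
fib-≤-suc (suc zero) = s≤s z≤n
fib-≤-suc (suc (suc n)) = m≤m+n (fib (2 + n)) (fib (1 + n))

minMoves-∸2≤fib : ∀ m → minMoves (m ∸ 2) ≤ fib (suc m)
minMoves-∸2≤fib zero = z≤n
minMoves-∸2≤fib (suc zero) = z≤n
minMoves-∸2≤fib (suc (suc k)) = begin
  minMoves k       ≤⟨ n≤1+n (minMoves k) ⟩
  suc (minMoves k) ≡⟨ suc-minMoves k ⟩
  fib (2 + k)      ≤⟨ fib-≤-suc (2 + k) ⟩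
  fib (3 + k)      ∎
  where open ≤-Reasoning

-- Configurations and a potential bounding transfer lengths from below

-- A configuration lists the pegs of disks 1, 2, 3, … in this order.
-- moveₖ i is the (i+2)-Fibonacci move: disks 1 … i+1 on Y, disk i+2 on X.
data Move′ : List Peg → List Peg → Set where
  move₁ : ∀ {x q rest} → q ≢ x → Move′ (x ∷ rest) (q ∷ rest)
  moveₖ : ∀ i {X Y rest} → X ≢ Y →
          Move′ (replicate (suc i) Y ++ X ∷ rest) (replicate i Y ++ third X Y ∷ third X Y ∷ rest)

data Path′ : List Peg → List Peg → Set where
  done : ∀ {s} → Path′ s s
  step : ∀ {s t u} → Move′ s t → Path′ t u → Path′ s u

moveWord′ : ∀ {s t} → Move′ s t → List Dir
moveWord′ (move₁ {x} {q} _) = dir x q ∷ []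
moveWord′ (moveₖ _ _) = []

length′ : ∀ {s t} → Path′ s t → ℕ
length′ done = 0
length′ (step _ p) = suc (length′ p)

word′ : ∀ {s t} → Path′ s t → List Dir
word′ done = []
word′ (step m p) = moveWord′ m ++ word′ p

-- potential s P bounds from below the number of moves gathering all disks of s on P. It is built
-- disk by disk: a misplaced disk m costs, on top of the smaller disks, the minimum of the route
-- through the third peg (1 + minMoves (m - 2)) and of the cruder bound 1 + fib (m + 1).
-- What matters is move-potential: a move lowers it by at most one.
addDisk : ℕ → Peg → (Peg → ℕ) → Peg → ℕ
addDisk m x f P with x ≟ₚ P
... | yes _ = f P
... | no _ = (f (third x P) + suc (minMoves (m ∸ 2))) ⊓ (f P + suc (fib (suc m)))

addDisks : ℕ → (Peg → ℕ) → List Peg → Peg → ℕ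
addDisks m f [] = f
addDisks m f (x ∷ xs) = addDisks (suc m) (addDisk (suc m) x f) xs

potential : List Peg → Peg → ℕ
potential = addDisks 0 (λ _ → 0)

addDisk-on : ∀ m x f → addDisk m x f x ≡ f x
addDisk-on m x f with x ≟ₚ x
... | yes _ = refl
... | no x≢x = ⊥-elim (x≢x refl)

addDisk-off : ∀ m {x P} f → x ≢ P →
  addDisk m x f P ≡ (f (third x P) + suc (minMoves (m ∸ 2))) ⊓ (f P + suc (fib (suc m)))
addDisk-off m {x} {P} f x≢P with x ≟ₚ P
... | yes x≡P = ⊥-elim (x≢P x≡P)
... | no _ = refl

addDisk-off-lower : ∀ m {x P} f → x ≢ P → suc (minMoves (m ∸ 2)) ≤ addDisk m x f P
addDisk-off-lower m {x} {P} f x≢P = begin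
  suc (minMoves (m ∸ 2))
    ≤⟨ ⊓-glb (m≤n+m _ (f (third x P))) (m≤n⇒m≤o+n (f P) (s≤s (minMoves-∸2≤fib m))) ⟩
  (f (third x P) + suc (minMoves (m ∸ 2))) ⊓ (f P + suc (fib (suc m)))
    ≡⟨ addDisk-off m f x≢P ⟨
  addDisk m x f P ∎
  where open ≤-Reasoning

addDisk-cong : ∀ m x {f g} → (∀ P → f P ≡ g P) → ∀ P → addDisk m x f P ≡ addDisk m x g P
addDisk-cong m x f≗g P with x ≟ₚ P
... | yes _ = f≗g P
... | no _ = cong₂ (λ u v → (u + _) ⊓ (v + _)) (f≗g (third x P)) (f≗g P)

addDisks-cong : ∀ m {f g} xs → (∀ P → f P ≡ g P) → ∀ P → addDisks m f xs P ≡ addDisks m g xs P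
addDisks-cong m [] f≗g = f≗g
addDisks-cong m (x ∷ xs) f≗g = addDisks-cong (suc m) xs (addDisk-cong (suc m) x f≗g)

addDisk-mono : ∀ m x {f g} → (∀ P → f P ≤ suc (g P)) → ∀ P → addDisk m x f P ≤ suc (addDisk m x g P)
addDisk-mono m x f≤g P with x ≟ₚ P
... | yes _ = f≤g P
... | no _ = ⊓-mono-≤ (+-monoˡ-≤ _ (f≤g (third x P))) (+-monoˡ-≤ _ (f≤g P))

addDisks-mono : ∀ m {f g} xs → (∀ P → f P ≤ suc (g P)) → ∀ P → addDisks m f xs P ≤ suc (addDisks m g xs P)
addDisks-mono m [] f≤g = f≤g
addDisks-mono m (x ∷ xs) f≤g = addDisks-mono (suc m) xs (addDisk-mono (suc m) x f≤g)

addDisks-++ : ∀ m f as bs → addDisks m f (as ++ bs) ≡ addDisks (m + List.length as) (addDisks m f as) bs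
addDisks-++ m f [] bs = cong (λ k → addDisks k f bs) (sym (+-identityʳ m))
addDisks-++ m f (x ∷ as) bs =
  trans (addDisks-++ (suc m) (addDisk (suc m) x f) as bs)
        (cong (λ k → addDisks k (addDisks (suc m) (addDisk (suc m) x f) as) bs)
              (sym (+-suc m (List.length as))))

addDisks-replicate-on : ∀ m f k Q → addDisks m f (replicate k Q) Q ≡ f Q
addDisks-replicate-on m f zero Q = refl
addDisks-replicate-on m f (suc k) Q =
  trans (addDisks-replicate-on (suc m) (addDisk (suc m) Q f) k Q) (addDisk-on (suc m) Q f)

potential-++ : ∀ as bs → potential (as ++ bs) ≡ addDisks (List.length as) (potential as) bs
potential-++ = addDisks-++ 0 (λ _ → 0)

potential-++-replicate-on : ∀ as k Q → potential (as ++ replicate k Q) Q ≡ potential as Q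
potential-++-replicate-on as k Q =
  trans (cong (λ h → h Q) (potential-++ as (replicate k Q))) (addDisks-replicate-on _ _ k Q)

perfect : ℕ → Peg → Peg → ℕ
perfect m Y P with Y ≟ₚ P
... | yes _ = 0
... | no _ = minMoves m

perfect-on : ∀ m Y → perfect m Y Y ≡ 0
perfect-on m Y with Y ≟ₚ Y
... | yes _ = refl
... | no Y≢Y = ⊥-elim (Y≢Y refl)

perfect-off : ∀ m {Y P} → Y ≢ P → perfect m Y P ≡ minMoves m
perfect-off m {Y} {P} Y≢P with Y ≟ₚ P
... | yes Y≡P = ⊥-elim (Y≢P Y≡P)
... | no _ = refl

addDisk-perfect : ∀ m Y P → addDisk (suc m) Y (perfect m Y) P ≡ perfect (suc m) Y P
addDisk-perfect m Y P = byCases (Y ≟ₚ P)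
  where
  open ≡-Reasoning
  byCases : Dec (Y ≡ P) → addDisk (suc m) Y (perfect m Y) P ≡ perfect (suc m) Y P
  byCases (yes refl) = trans (addDisk-on (suc m) Y _) (trans (perfect-on m Y) (sym (perfect-on (suc m) Y)))
  byCases (no Y≢P) = begin
    addDisk (suc m) Y (perfect m Y) P
      ≡⟨ addDisk-off (suc m) _ Y≢P ⟩
    (perfect m Y (third Y P) + suc (minMoves (m ∸ 1))) ⊓ (perfect m Y P + suc (fib (2 + m)))
      ≡⟨ cong₂ (λ u v → (u + _) ⊓ (v + _))
               (perfect-off m (≢-sym (third-≢ˡ Y P))) (perfect-off m Y≢P) ⟩
    (minMoves m + suc (minMoves (m ∸ 1))) ⊓ (minMoves m + suc (fib (2 + m)))
      ≡⟨ m≤n⇒m⊓n≡m (+-monoʳ-≤ (minMoves m) (s≤s (minMoves-∸2≤fib (suc m)))) ⟩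
    minMoves m + suc (minMoves (m ∸ 1))
      ≡⟨ minMoves-suc m ⟨
    minMoves (suc m)
      ≡⟨ perfect-off (suc m) Y≢P ⟨
    perfect (suc m) Y P ∎

perfect-zero : ∀ Y P → perfect 0 Y P ≡ 0
perfect-zero Y P with Y ≟ₚ P
... | yes _ = refl
... | no _ = refl

addDisks-perfect : ∀ k j Y P → addDisks k (perfect k Y) (replicate j Y) P ≡ perfect (k + j) Y P
addDisks-perfect k zero Y P = cong (λ n → perfect n Y P) (sym (+-identityʳ k))
addDisks-perfect k (suc j) Y P = begin
  addDisks (suc k) (addDisk (suc k) Y (perfect k Y)) (replicate j Y) P
    ≡⟨ addDisks-cong (suc k) (replicate j Y) (addDisk-perfect k Y) P ⟩
  addDisks (suc k) (perfect (suc k) Y) (replicate j Y) P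
    ≡⟨ addDisks-perfect (suc k) j Y P ⟩
  perfect (suc k + j) Y P
    ≡⟨ cong (λ n → perfect n Y P) (+-suc k j) ⟨
  perfect (k + suc j) Y P ∎
  where open ≡-Reasoning

potential-replicate : ∀ m Y P → potential (replicate m Y) P ≡ perfect m Y P
potential-replicate m Y P =
  trans (addDisks-cong 0 (replicate m Y) (λ Q → sym (perfect-zero Y Q)) P) (addDisks-perfect 0 m Y P)

potential-replicate-++ : ∀ i Y bs P → potential (replicate i Y ++ bs) P ≡ addDisks i (perfect i Y) bs P
potential-replicate-++ i Y bs P = begin
  potential (replicate i Y ++ bs) P
    ≡⟨ cong (λ h → h P) (potential-++ (replicate i Y) bs) ⟩
  addDisks (List.length (replicate i Y)) (potential (replicate i Y)) bs P
    ≡⟨ cong (λ k → addDisks k (potential (replicate i Y)) bs P) (length-replicate i) ⟩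
  addDisks i (potential (replicate i Y)) bs P
    ≡⟨ addDisks-cong i bs (potential-replicate i Y) P ⟩
  addDisks i (perfect i Y) bs P ∎
  where open ≡-Reasoning

potential-pair : ∀ i Y Z rr Q →
  potential (replicate i Y ++ Z ∷ Z ∷ replicate rr Q) Q ≡ addDisk (2 + i) Z (addDisk (1 + i) Z (perfect i Y)) Q
potential-pair i Y Z rr Q =
  trans (potential-replicate-++ i Y (Z ∷ Z ∷ replicate rr Q) Q) (addDisks-replicate-on (2 + i) _ rr Q)

fib-3+ : ∀ i → fib (3 + i) ≡ suc (minMoves i) + suc (minMoves (i ∸ 1))
fib-3+ i = trans (sym (suc-minMoves (1 + i))) (cong suc (minMoves-suc i))

pair-lower : ∀ i {X Y} → X ≢ Y →
  minMoves (1 + i) ≤ addDisk (2 + i) (third X Y) (addDisk (1 + i) (third X Y) (perfect i Y)) X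
pair-lower i {X} {Y} X≢Y = begin
  minMoves (1 + i)
    ≤⟨ ⊓-glb viaThird direct ⟩
  (h (third Z X) + suc (minMoves i)) ⊓ (h X + suc (fib (3 + i)))
    ≡⟨ addDisk-off (2 + i) h (third-≢ˡ X Y) ⟨
  addDisk (2 + i) Z h X ∎
  where
  open ≤-Reasoning
  Z = third X Y
  h = addDisk (1 + i) Z (perfect i Y)
  viaThird : minMoves (1 + i) ≤ h (third Z X) + suc (minMoves i)
  viaThird = begin
    minMoves (1 + i)                       ≡⟨ minMoves-suc i ⟩
    minMoves i + suc (minMoves (i ∸ 1))    ≡⟨ +-comm (minMoves i) _ ⟩
    suc (minMoves (i ∸ 1)) + minMoves i
      ≤⟨ +-mono-≤ (addDisk-off-lower (1 + i) (perfect i Y) (≢-sym (third-≢ˡ Z X))) (n≤1+n _) ⟩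
    h (third Z X) + suc (minMoves i)       ∎
  direct : minMoves (1 + i) ≤ h X + suc (fib (3 + i))
  direct = m≤n⇒m≤o+n (h X) (≤-trans (n≤1+n _) (≤-trans (≤-reflexive (suc-minMoves (1 + i))) (n≤1+n _)))

pair-move-potential : ∀ i {X Y} → X ≢ Y → ∀ P →
  addDisk (2 + i) X (perfect (1 + i) Y) P ≤
  suc (addDisk (2 + i) (third X Y) (addDisk (1 + i) (third X Y) (perfect i Y)) P)
pair-move-potential i {X} {Y} X≢Y P with peg-trichotomy X≢Y P
... | inj₁ refl = begin
  addDisk (2 + i) X (perfect (1 + i) Y) X ≡⟨ addDisk-on (2 + i) X _ ⟩
  perfect (1 + i) Y X                     ≡⟨ perfect-off (1 + i) (≢-sym X≢Y) ⟩
  minMoves (1 + i)                        ≤⟨ pair-lower i X≢Y ⟩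
  addDisk (2 + i) Z h X                   <⟨ n<1+n _ ⟩
  suc (addDisk (2 + i) Z h X)             ∎
  where
  open ≤-Reasoning
  Z = third X Y
  h = addDisk (1 + i) Z (perfect i Y)
... | inj₂ (inj₁ refl) = begin
  addDisk (2 + i) X g Y
    ≡⟨ addDisk-off (2 + i) g X≢Y ⟩
  (g (third X Y) + suc (minMoves i)) ⊓ (g Y + suc (fib (3 + i)))
    ≤⟨ m⊓n≤n _ _ ⟩
  g Y + suc (fib (3 + i))
    ≡⟨ cong (λ n → n + suc (fib (3 + i))) (perfect-on (1 + i) Y) ⟩
  suc (fib (3 + i))
    ≤⟨ s≤s (⊓-glb viaThird (m≤n⇒m≤o+n (h Y) (n≤1+n _))) ⟩
  suc ((h (third Z Y) + suc (minMoves i)) ⊓ (h Y + suc (fib (3 + i))))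
    ≡⟨ cong suc (addDisk-off (2 + i) h (third-≢ʳ X Y)) ⟨
  suc (addDisk (2 + i) Z h Y) ∎
  where
  open ≤-Reasoning
  Z = third X Y
  g = perfect (1 + i) Y
  h = addDisk (1 + i) Z (perfect i Y)
  viaThird : fib (3 + i) ≤ h (third Z Y) + suc (minMoves i)
  viaThird = begin
    fib (3 + i)                                   ≡⟨ fib-3+ i ⟩
    suc (minMoves i) + suc (minMoves (i ∸ 1))     ≡⟨ +-comm (suc (minMoves i)) _ ⟩
    suc (minMoves (i ∸ 1)) + suc (minMoves i)
      ≤⟨ +-monoˡ-≤ _ (addDisk-off-lower (1 + i) (perfect i Y) (≢-sym (third-≢ˡ Z Y))) ⟩
    h (third Z Y) + suc (minMoves i)              ∎
... | inj₂ (inj₂ refl) = begin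
  addDisk (2 + i) X g Z
    ≡⟨ addDisk-off (2 + i) g (≢-sym (third-≢ˡ X Y)) ⟩
  (g (third X Z) + suc (minMoves i)) ⊓ (g Z + suc (fib (3 + i)))
    ≤⟨ m⊓n≤m _ _ ⟩
  g (third X Z) + suc (minMoves i)
    ≡⟨ cong (λ P → g P + suc (minMoves i)) (third-third X≢Y) ⟩
  g Y + suc (minMoves i)
    ≡⟨ cong (λ n → n + suc (minMoves i)) (perfect-on (1 + i) Y) ⟩
  suc (minMoves i)
    ≡⟨ cong suc (perfect-off i (≢-sym (third-≢ʳ X Y))) ⟨
  suc (perfect i Y Z)
    ≡⟨ cong suc (addDisk-on (1 + i) Z (perfect i Y)) ⟨
  suc (addDisk (1 + i) Z (perfect i Y) Z)
    ≡⟨ cong suc (addDisk-on (2 + i) Z _) ⟨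
  suc (addDisk (2 + i) Z (addDisk (1 + i) Z (perfect i Y)) Z) ∎
  where
  open ≤-Reasoning
  Z = third X Y
  g = perfect (1 + i) Y

smallest-potential : ∀ x P → addDisk 1 x (λ _ → 0) P ≤ 1
smallest-potential x P with x ≟ₚ P
... | yes _ = z≤n
... | no _ = m⊓n≤m 1 2

move-potential : ∀ {s t} → Move′ s t → ∀ P → potential s P ≤ suc (potential t P)
move-potential (move₁ {x} {q} {rest} _) =
  addDisks-mono 1 rest (λ P → ≤-trans (smallest-potential x P) (s≤s z≤n))
move-potential (moveₖ i {X} {Y} {rest} X≢Y) P = begin
  potential (replicate (suc i) Y ++ X ∷ rest) P
    ≡⟨ potential-replicate-++ (suc i) Y (X ∷ rest) P ⟩
  addDisks (2 + i) (addDisk (2 + i) X (perfect (1 + i) Y)) rest P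
    ≤⟨ addDisks-mono (2 + i) rest (pair-move-potential i X≢Y) P ⟩
  suc (addDisks (2 + i) (addDisk (2 + i) Z (addDisk (1 + i) Z (perfect i Y))) rest P)
    ≡⟨ cong suc (potential-replicate-++ i Y (Z ∷ Z ∷ rest) P) ⟨
  suc (potential (replicate i Y ++ Z ∷ Z ∷ rest) P) ∎
  where
  open ≤-Reasoning
  Z = third X Y

path-potential : ∀ {s g} (p : Path′ s g) → ∀ P → potential s P ≤ length′ p + potential g P
path-potential done P = ≤-refl
path-potential (step m p) P = ≤-trans (move-potential m P) (s≤s (path-potential p P))

potential≤length′ : ∀ {s g} (p : Path′ s g) {n Q} → g ≡ replicate n Q → potential s Q ≤ length′ p
potential≤length′ {s} p {n} {Q} refl = begin
  potential s Q                              ≤⟨ path-potential p Q ⟩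
  length′ p + potential (replicate n Q) Q    ≡⟨ cong (length′ p +_) (potential-replicate n Q Q) ⟩
  length′ p + perfect n Q Q                  ≡⟨ cong (length′ p +_) (perfect-on n Q) ⟩
  length′ p + 0                              ≡⟨ +-identityʳ (length′ p) ⟩
  length′ p                                  ∎
  where open ≤-Reasoning

potential-tower : ∀ m {Y Q} rr → Y ≢ Q → potential (replicate m Y ++ replicate rr Q) Q ≡ minMoves m
potential-tower m {Y} {Q} rr Y≢Q = begin
  potential (replicate m Y ++ replicate rr Q) Q ≡⟨ potential-++-replicate-on (replicate m Y) rr Q ⟩
  potential (replicate m Y) Q                   ≡⟨ potential-replicate m Y Q ⟩
  perfect m Y Q                                 ≡⟨ perfect-off m Y≢Q ⟩
  minMoves m                                    ∎
  where open ≡-Reasoning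

potential-misplaced-smallest : ∀ {q Q} rr → q ≢ Q → 1 ≤ potential (q ∷ replicate rr Q) Q
potential-misplaced-smallest {q} {Q} rr q≢Q =
  subst (1 ≤_) (sym (addDisks-replicate-on 1 _ rr Q)) (addDisk-off-lower 1 (λ _ → 0) q≢Q)

potential-misplaced-pair : ∀ i Y {Z Q} rr → Z ≢ Q →
  suc (minMoves i) ≤ potential (replicate i Y ++ Z ∷ Z ∷ replicate rr Q) Q
potential-misplaced-pair i Y rr Z≢Q =
  subst (suc (minMoves i) ≤_) (sym (potential-pair i Y _ rr _)) (addDisk-off-lower (2 + i) _ Z≢Q)

potential-pair-third : ∀ i {Y Q} rr → Y ≢ Q →
  minMoves (1 + i) ≤ potential (replicate i Y ++ third Q Y ∷ third Q Y ∷ replicate rr Q) Q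
potential-pair-third i {Y} {Q} rr Y≢Q =
  subst (minMoves (1 + i) ≤_) (sym (potential-pair i Y _ rr Q)) (pair-lower i (≢-sym Y≢Q))

replicate-snoc : ∀ m (Y : Peg) u → replicate (suc m) Y ++ u ≡ replicate m Y ++ Y ∷ u
replicate-snoc zero Y u = refl
replicate-snoc (suc m) Y u = cong (Y ∷_) (replicate-snoc m Y u)

cast : ∀ {s s′ g g′} → s ≡ s′ → g ≡ g′ → Path′ s g → Path′ s′ g′
cast refl refl p = p

length′-cast : ∀ {s s′ g g′} (s≡s′ : s ≡ s′) (g≡g′ : g ≡ g′) p → length′ (cast s≡s′ g≡g′ p) ≡ length′ p
length′-cast refl refl p = refl

_++ₚ_ : ∀ {s t u} → Path′ s t → Path′ t u → Path′ s u
done ++ₚ q = q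
step m p ++ₚ q = step m (p ++ₚ q)

length′-++ₚ : ∀ {s t u} (p : Path′ s t) (q : Path′ t u) → length′ (p ++ₚ q) ≡ length′ p + length′ q
length′-++ₚ done q = refl
length′-++ₚ (step m p) q = cong suc (length′-++ₚ p q)

TowerPath : ℕ → Peg → Peg → List Peg → Set
TowerPath m Y Q rest = Σ[ p ∈ Path′ (replicate m Y ++ rest) (replicate m Q ++ rest) ] length′ p ≡ minMoves m

towerPath-suc² : ∀ i {Y Q} rest (Y≢Q : Y ≢ Q) →
  TowerPath (1 + i) Y (third Y Q) (Y ∷ rest) → TowerPath i (third Y Q) Q (Q ∷ Q ∷ rest) →
  TowerPath (2 + i) Y Q rest
towerPath-suc² i {Y} {Q} rest Y≢Q (p₁ , length₁) (p₂ , length₂) =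
  cast (sym start≡) (sym goal≡) p , length≡
  where
  R = third Y Q
  lands : replicate i R ++ Q ∷ Q ∷ rest ≡ replicate i R ++ third Y R ∷ third Y R ∷ rest
  lands = cong (λ Z → replicate i R ++ Z ∷ Z ∷ rest) (sym (third-third Y≢Q))
  p = p₁ ++ₚ step (moveₖ i (≢-sym (third-≢ˡ Y Q))) (cast lands refl p₂)
  start≡ : replicate (2 + i) Y ++ rest ≡ replicate (1 + i) Y ++ Y ∷ rest
  start≡ = replicate-snoc (suc i) Y rest
  goal≡ : replicate (2 + i) Q ++ rest ≡ replicate i Q ++ Q ∷ Q ∷ rest
  goal≡ = trans (replicate-snoc (suc i) Q rest) (replicate-snoc i Q (Q ∷ rest))
  length≡ : length′ (cast (sym start≡) (sym goal≡) p) ≡ minMoves (2 + i)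
  length≡ = begin
    length′ (cast (sym start≡) (sym goal≡) p)
      ≡⟨ length′-cast (sym start≡) (sym goal≡) p ⟩
    length′ p
      ≡⟨ length′-++ₚ p₁ _ ⟩
    length′ p₁ + suc (length′ (cast lands refl p₂))
      ≡⟨ cong₂ (λ u v → u + suc v) length₁ (trans (length′-cast lands refl p₂) length₂) ⟩
    minMoves (1 + i) + suc (minMoves i) ∎
    where open ≡-Reasoning

towerPath : ∀ m {Y Q} rest → Y ≢ Q → TowerPath m Y Q rest
towerPath zero rest _ = done , refl
towerPath (suc zero) rest Y≢Q = step (move₁ (≢-sym Y≢Q)) done , refl
towerPath (suc (suc i)) {Y} {Q} rest Y≢Q =
  towerPath-suc² i rest Y≢Q (towerPath (suc i) (Y ∷ rest) (≢-sym (third-≢ˡ Y Q)))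
                            (towerPath i (Q ∷ Q ∷ rest) (third-≢ʳ Y Q))

-- Uniqueness of the optimal word

length-++-cons² : ∀ (as : List Peg) {x y x′ y′} rest →
  List.length (as ++ x ∷ y ∷ rest) ≡ List.length (as ++ x′ ∷ y′ ∷ rest)
length-++-cons² [] rest = refl
length-++-cons² (_ ∷ as) rest = cong suc (length-++-cons² as rest)

move-length : ∀ {s t} → Move′ s t → List.length s ≡ List.length t
move-length (move₁ _) = refl
move-length (moveₖ i {X} {Y} {rest} _) =
  trans (cong List.length (replicate-snoc i Y (X ∷ rest))) (length-++-cons² (replicate i Y) rest)

path-length : ∀ {s t} → Path′ s t → List.length s ≡ List.length t
path-length done = refl
path-length (step m p) = trans (move-length m) (path-length p)

split-replicate : ∀ n (Y : Peg) u as bs → replicate n Y ++ u ≡ as ++ bs →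
  (Σ[ c ∈ ℕ ] List.length as + c ≡ n × as ≡ replicate (List.length as) Y × bs ≡ replicate c Y ++ u)
  ⊎ (Σ[ as₂ ∈ List Peg ] as ≡ replicate n Y ++ as₂ × u ≡ as₂ ++ bs)
split-replicate zero Y u as bs e = inj₂ (as , refl , e)
split-replicate (suc n) Y u [] bs e = inj₁ (suc n , refl , refl , sym e)
split-replicate (suc n) Y u (a ∷ as) bs e with ∷-injective e
... | refl , e′ with split-replicate n Y u as bs e′
...   | inj₁ (c , length≡ , as≡ , bs≡) = inj₁ (c , cong suc length≡ , cong (a ∷_) as≡ , bs≡)
...   | inj₂ (as₂ , as≡ , u≡) = inj₂ (as₂ , cong (a ∷_) as≡ , u≡)

-- A move from as ++ bs to t that displaces a disk of bs: disk 1 when as is empty, or an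
-- (i+2)-Fibonacci move whose tower 1 … i+1 consists of as and the first c disks of bs.
data BoundaryMove (as bs t : List Peg) : List Dir → Set where
  smallest : ∀ {x q rest} → q ≢ x → as ≡ [] → bs ≡ x ∷ rest → t ≡ q ∷ rest →
             BoundaryMove as bs t (dir x q ∷ [])
  pair : ∀ i c {X Y rest} → X ≢ Y → as ≡ replicate (List.length as) Y → bs ≡ replicate c Y ++ X ∷ rest →
         List.length as + c ≡ suc i → t ≡ replicate i Y ++ third X Y ∷ third X Y ∷ rest →
         BoundaryMove as bs t []

classify : ∀ {s t} (m : Move′ s t) as bs → s ≡ as ++ bs →
  (Σ[ as′ ∈ List Peg ] t ≡ as′ ++ bs × Σ[ m′ ∈ Move′ as as′ ] moveWord′ m′ ≡ moveWord′ m)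
  ⊎ BoundaryMove as bs t (moveWord′ m)
classify (move₁ q≢x) [] bs s≡ = inj₂ (smallest q≢x refl (sym s≡) refl)
classify (move₁ {q = q} q≢x) (_ ∷ as) bs refl = inj₁ (q ∷ as , refl , move₁ q≢x , refl)
classify (moveₖ i {X} {Y} {rest} X≢Y) as bs s≡ with split-replicate (suc i) Y (X ∷ rest) as bs s≡
... | inj₁ (c , length≡ , as≡ , bs≡) = inj₂ (pair i c X≢Y as≡ bs≡ length≡ refl)
... | inj₂ ([] , refl , u≡) =
  inj₂ (pair i 0 X≢Y (trans (++-identityʳ _) (cong (λ k → replicate k Y) (sym length≡))) (sym u≡)
             (trans (+-identityʳ _) length≡) refl)
  where
  length≡ : List.length (replicate (suc i) Y ++ []) ≡ suc i
  length≡ = trans (cong List.length (++-identityʳ (replicate (suc i) Y))) (length-replicate (suc i))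
... | inj₂ (x ∷ as₃ , refl , refl) =
  inj₁ (replicate i Y ++ third x Y ∷ third x Y ∷ as₃ , sym (++-assoc (replicate i Y) _ bs) ,
        moveₖ i X≢Y , refl)

record FirstBoundaryMove {s g} (p : Path′ s g) (as bs : List Peg) : Set where
  field
    {as′ t} : List Peg
    {w} : List Dir
    before : Path′ as as′
    boundary : BoundaryMove as′ bs t w
    after : Path′ t g
    length-split : length′ p ≡ length′ before + suc (length′ after)
    word-split : word′ p ≡ word′ before ++ w ++ word′ after

split-at-boundary : ∀ {s g} (p : Path′ s g) as bs → s ≡ as ++ bs →
  (Σ[ as′ ∈ List Peg ] g ≡ as′ ++ bs) ⊎ FirstBoundaryMove p as bs
split-at-boundary done as bs s≡ = inj₁ (as , s≡)
split-at-boundary (step m p) as bs s≡ with classify m as bs s≡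
... | inj₂ b =
  inj₂ (record { before = done ; boundary = b ; after = p ; length-split = refl ; word-split = refl })
... | inj₁ (as″ , t≡ , m′ , word≡) with split-at-boundary p as″ bs t≡
...   | inj₁ g≡ = inj₁ g≡
...   | inj₂ f = inj₂ (record
  { before = step m′ before
  ; boundary = boundary
  ; after = after
  ; length-split = cong suc length-split
  ; word-split = trans (cong₂ _++_ (sym word≡) word-split)
                       (sym (++-assoc (moveWord′ m′) (word′ before) _))
  })
  where open FirstBoundaryMove f

TowerWordUnique : ℕ → Set
TowerWordUnique m = ∀ {Y Q} rr {s g} → Y ≢ Q → s ≡ replicate m Y ++ replicate rr Q → g ≡ replicate (m + rr) Q →
  (p : Path′ s g) → length′ p ≤ minMoves m → word′ p ≡ towerWord Y Q m

tower-lower : ∀ m {Y Q} rr {n s g} → Y ≢ Q → (p : Path′ s g) →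
  s ≡ replicate m Y ++ replicate rr Q → g ≡ replicate n Q → minMoves m ≤ length′ p
tower-lower m rr Y≢Q p refl g≡ = subst (_≤ length′ p) (potential-tower m rr Y≢Q) (potential≤length′ p g≡)

tower-lower₀ : ∀ m {Y Q} → Y ≢ Q → (p : Path′ (replicate m Y) (replicate m Q)) → minMoves m ≤ length′ p
tower-lower₀ m Y≢Q p = tower-lower m 0 Y≢Q p (sym (++-identityʳ _)) refl

length′≡0 : ∀ {s t} (p : Path′ s t) → length′ p ≡ 0 → word′ p ≡ []
length′≡0 done _ = refl

replicate-middle : ∀ n {Q : Peg} as {y} bs → replicate n Q ≡ as ++ y ∷ bs → y ≡ Q
replicate-middle (suc n) [] bs e = sym (∷-injectiveˡ e)
replicate-middle (suc n) (_ ∷ as) bs e = replicate-middle n as bs (∷-injectiveʳ e)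

+-≤-tight : ∀ {a b a₀ b₀} → a + suc b ≤ a₀ + suc b₀ → a₀ ≤ a → b₀ ≤ b → a ≤ a₀ × b ≤ b₀
+-≤-tight {a} {b} {a₀} {b₀} sum≤ a₀≤a b₀≤b =
  +-cancelʳ-≤ (suc b₀) a a₀ (≤-trans (+-monoʳ-≤ a (s≤s b₀≤b)) sum≤) ,
  ≤-pred (+-cancelˡ-≤ a₀ (suc b) (suc b₀) (≤-trans (+-monoˡ-≤ (suc b) a₀≤a) sum≤))

overshoot : ∀ {a b a₀ b₀} → a₀ ≤ a → suc b₀ ≤ b → a₀ + suc b₀ < a + suc b
overshoot a₀≤a b₀<b = +-mono-≤-< a₀≤a (s≤s b₀<b)

first-move-smallest : ∀ {Y Q q} rr {s g} → g ≡ replicate (suc rr) Q →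
  (before : Path′ s []) (after : Path′ (q ∷ replicate rr Q) g) →
  length′ before + suc (length′ after) ≤ 1 → word′ before ++ (dir Y q ∷ []) ++ word′ after ≡ towerWord Y Q 1
first-move-smallest {Y} {Q} {q} rr g≡ before after short with q ≟ₚ Q
... | yes refl =
  trans (cong₂ (λ u v → u ++ dir Y Q ∷ v) (length′≡0 before (n≤0⇒n≡0 before≤0))
                                           (length′≡0 after (n≤0⇒n≡0 after≤0)))
        (sym (orient-[l] (dir Y Q)))
  where
  before≤0 = proj₁ (+-≤-tight short z≤n z≤n)
  after≤0 = proj₂ (+-≤-tight short z≤n z≤n)
... | no q≢Q = ⊥-elim (<⇒≱ (overshoot z≤n after≥1) short)
  where
  after≥1 : 1 ≤ length′ after
  after≥1 = ≤-trans (potential-misplaced-smallest rr q≢Q) (potential≤length′ after g≡)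

-- The largest disk i+2 of the tower leaves Y in a move carrying the tower 1 … i+1 from Y′ along;
-- optimality forces Y′ to be the third peg and both remaining stages to be optimal.
first-move-carry : ∀ i {Y Q Y′} rr → TowerWordUnique (1 + i) → TowerWordUnique i → Y ≢ Q → Y ≢ Y′ →
  (before : Path′ (replicate (1 + i) Y) (replicate (1 + i) Y′)) →
  (after : Path′ (replicate i Y′ ++ third Y Y′ ∷ third Y Y′ ∷ replicate rr Q) (replicate (2 + i + rr) Q)) →
  length′ before + suc (length′ after) ≤ minMoves (2 + i) →
  word′ before ++ word′ after ≡ towerWord Y Q (2 + i)
first-move-carry i {Y} {Q} {Y′} rr unique₁ unique₀ Y≢Q Y≢Y′ before after short
  with peg-trichotomy Y≢Q Y′
... | inj₁ refl = ⊥-elim (Y≢Y′ refl)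
... | inj₂ (inj₁ refl) = ⊥-elim (<⇒≱ (overshoot before≥ after>) short)
  where
  before≥ = tower-lower₀ (1 + i) Y≢Q before
  after> = ≤-trans (potential-misplaced-pair i Q rr (third-≢ʳ Y Q)) (potential≤length′ after refl)
... | inj₂ (inj₂ refl) = begin
  word′ before ++ word′ after                 ≡⟨ cong₂ _++_ before-word after-word ⟩
  towerWord Y R (1 + i) ++ towerWord R Q i    ≡⟨ towerWord-suc² i Y≢Q ⟩
  towerWord Y Q (2 + i)                       ∎
  where
  open ≡-Reasoning
  R = third Y Q
  R-lands : replicate i R ++ third Y R ∷ third Y R ∷ replicate rr Q ≡ replicate i R ++ replicate (2 + rr) Q
  R-lands = cong (λ Z → replicate i R ++ Z ∷ Z ∷ replicate rr Q) (third-third Y≢Q)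
  bounds = +-≤-tight short (tower-lower₀ (1 + i) (≢-sym (third-≢ˡ Y Q)) before)
                           (tower-lower i (2 + rr) (third-≢ʳ Y Q) after R-lands refl)
  before-word : word′ before ≡ towerWord Y R (1 + i)
  before-word = unique₁ 0 (≢-sym (third-≢ˡ Y Q)) (sym (++-identityʳ _))
                  (cong (λ k → replicate k R) (sym (+-identityʳ (1 + i)))) before (proj₁ bounds)
  after-word : word′ after ≡ towerWord R Q i
  after-word = unique₀ (2 + rr) (third-≢ʳ Y Q) R-lands
                 (cong (λ k → replicate k Q) (sym (trans (+-suc i (suc rr)) (cong suc (+-suc i rr)))))
                 after (proj₂ bounds)

-- Disk m + 1 is carried onto the third peg by the move of disk m + 2; the configuration reached
-- is already minMoves (m + 1) moves away from the target.
first-move-lift : ∀ m {Y Q} rr {s s′ n} → Y ≢ Q → (before : Path′ s s′) →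
  (after : Path′ (replicate m Y ++ third Q Y ∷ third Q Y ∷ replicate rr Q) (replicate n Q)) →
  minMoves (suc m) < length′ before + suc (length′ after)
first-move-lift m rr Y≢Q before after =
  ≤-trans (s≤s (≤-trans (potential-pair-third m rr Y≢Q) (potential≤length′ after refl)))
          (m≤n+m _ (length′ before))

length-from-replicate : ∀ {m} {Y : Peg} {as′} → Path′ (replicate m Y) as′ → List.length as′ ≡ m
length-from-replicate {m} before = trans (sym (path-length before)) (length-replicate m)

first-move-word : ∀ m {Y Q} rr {as′ t w} → (∀ {k} → k < suc m → TowerWordUnique k) → Y ≢ Q →
  (before : Path′ (replicate m Y) as′) → BoundaryMove as′ (Y ∷ replicate rr Q) t w →
  (after : Path′ t (replicate (suc m + rr) Q)) →
  length′ before + suc (length′ after) ≤ minMoves (suc m) →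
  word′ before ++ w ++ word′ after ≡ towerWord Y Q (suc m)
first-move-word zero rr _ _ before (smallest _ refl refl refl) after short =
  first-move-smallest rr refl before after short
first-move-word (suc m) rr _ _ before (smallest _ refl _ _) _ _ with path-length before
... | ()
first-move-word m rr unique Y≢Q before (pair i zero Y≢Y′ as′≡ refl length≡ refl) after short
  with trans (sym (trans (+-identityʳ _) (length-from-replicate before))) length≡
... | refl with trans as′≡ (cong (λ k → replicate k _) (length-from-replicate before))
...   | refl = first-move-carry i rr (unique (n<1+n (suc i))) (unique (m<n⇒m<1+n (n<1+n i)))
                 Y≢Q Y≢Y′ before after short
first-move-word m zero _ _ _ (pair _ (suc zero) _ _ () _ _) _ _
first-move-word m (suc rr) _ Y≢Q before (pair i (suc zero) _ as′≡ refl length≡ refl) after short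
  with trans (sym (trans (+-comm _ 1) (cong suc (length-from-replicate before)))) length≡
... | refl = ⊥-elim (<⇒≱ (first-move-lift m rr Y≢Q before after) short)
first-move-word m zero _ _ _ (pair _ (suc (suc _)) _ _ () _ _) _ _
first-move-word m (suc rr) _ Y≢Q _ (pair _ (suc (suc _)) _ _ bs≡ _ _) _ _ =
  ⊥-elim (Y≢Q (trans (∷-injectiveˡ bs≡) (sym (∷-injectiveˡ (∷-injectiveʳ bs≡)))))

unique-zero : TowerWordUnique 0
unique-zero {Y} {Q} rr Y≢Q s≡ g≡ done short = sym (orient-[] (dir Y Q))

unique-suc : ∀ m → (∀ {k} → k < suc m → TowerWordUnique k) → TowerWordUnique (suc m)
unique-suc m unique {Y} {Q} rr Y≢Q refl refl p short
  with split-at-boundary p (replicate m Y) (Y ∷ replicate rr Q) (replicate-snoc m Y (replicate rr Q))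
... | inj₁ (as′ , g≡) = ⊥-elim (Y≢Q (replicate-middle (suc m + rr) as′ (replicate rr Q) g≡))
... | inj₂ f = trans word-split
  (first-move-word m rr unique Y≢Q before boundary after (subst (_≤ minMoves (suc m)) length-split short))
  where open FirstBoundaryMove f

towerWord-unique : ∀ m → TowerWordUnique m
towerWord-unique = <-rec TowerWordUnique λ where
  zero _ → unique-zero
  (suc m) unique → unique-suc m unique

-- From the states of the game to configurations

pair-move-shape : ∀ {n} (s : State n) (k′ k : Fin n) {X Y Z} → suc (toℕ k′) ≡ toℕ k →
  (∀ j → toℕ j < toℕ k → lookup s j ≡ Y) → lookup s k ≡ X →
  Σ[ rest ∈ List Peg ] toList s ≡ replicate (suc (toℕ k′)) Y ++ X ∷ rest
                     × toList ((s [ k ]≔ Z) [ k′ ]≔ Z) ≡ replicate (toℕ k′) Y ++ Z ∷ Z ∷ rest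
pair-move-shape (y ∷ᵥ x ∷ᵥ xs) fzero (fsuc fzero) _ belowY onX with belowY fzero (s≤s z≤n) | onX
... | refl | refl = toList xs , refl , refl
pair-move-shape (y ∷ᵥ s) (fsuc k′) (fsuc k) k≡ belowY onX with belowY fzero (s≤s z≤n)
... | refl with pair-move-shape s k′ k (suc-injective k≡) (λ j j<k → belowY (fsuc j) (s≤s j<k)) onX
...   | rest , s≡ , t≡ = rest , cong (y ∷_) s≡ , cong (y ∷_) t≡

fromMove : ∀ {n} {s t : State n} (m : Move s t) →
  Σ[ m′ ∈ Move′ (toList s) (toList t) ] moveWord′ m′ ≡ moveWord m
fromMove {s = x ∷ᵥ xs} (fib1 fzero _ q q≢x) = move₁ q≢x , refl
fromMove {s = s} (fibK k k′ k≡ X Y Z X≢Y Z≢X Z≢Y onX _ belowY _ _) with third-unique X≢Y Z≢X Z≢Y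
... | refl with pair-move-shape s k′ k {Z = Z} k≡ belowY onX
...   | rest , s≡ , t≡ rewrite s≡ | t≡ = moveₖ (toℕ k′) X≢Y , refl

record PairSite {n} (s : State n) (i : ℕ) (X Y : Peg) (rest : List Peg) : Set where
  field
    k′ k : Fin n
    k′+1≡k : suc (toℕ k′) ≡ toℕ k
    onX : lookup s k ≡ X
    belowY : ∀ j → toℕ j < toℕ k → lookup s j ≡ Y
    landed : ∀ Z → toList ((s [ k ]≔ Z) [ k′ ]≔ Z) ≡ replicate i Y ++ Z ∷ Z ∷ rest

pairSite : ∀ {n} (s : State n) i X Y rest → replicate (suc i) Y ++ X ∷ rest ≡ toList s → PairSite s i X Y rest
pairSite (y ∷ᵥ x ∷ᵥ xs) zero X Y rest refl = record
  { k′ = fzero ; k = fsuc fzero ; k′+1≡k = refl ; onX = refl ; belowY = belowY ; landed = λ _ → refl }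
  where
  belowY : ∀ j → toℕ j < 1 → lookup (y ∷ᵥ x ∷ᵥ xs) j ≡ y
  belowY fzero _ = refl
  belowY (fsuc j) (s≤s ())
pairSite (y ∷ᵥ s) (suc i) X Y rest s≡ with ∷-injective s≡
... | refl , s≡′ = record
  { k′ = fsuc k′ ; k = fsuc k ; k′+1≡k = cong suc k′+1≡k ; onX = onX ; belowY = belowY′
  ; landed = λ Z → cong (Y ∷_) (landed Z) }
  where
  open PairSite (pairSite s i X Y rest s≡′)
  belowY′ : ∀ j → toℕ j < suc (toℕ k) → lookup (Y ∷ᵥ s) j ≡ Y
  belowY′ fzero _ = refl
  belowY′ (fsuc j) (s≤s j<k) = belowY j j<k

toMove : ∀ {n} (s : State n) {S T} (m′ : Move′ S T) → S ≡ toList s →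
  Σ[ t ∈ State n ] toList t ≡ T × Move s t
toMove (x ∷ᵥ xs) (move₁ {q = q} q≢x) refl = q ∷ᵥ xs , refl , fib1 fzero refl q q≢x
toMove s (moveₖ i {X} {Y} {rest} X≢Y) S≡ =
  (s [ k ]≔ Z) [ k′ ]≔ Z , landed Z ,
  fibK k k′ k′+1≡k X Y Z X≢Y (third-≢ˡ X Y) (third-≢ʳ X Y) onX topX belowY splitY aboveZ
  where
  open PairSite (pairSite s i X Y rest S≡)
  Z = third X Y
  topX : ∀ j → lookup s j ≡ X → toℕ k ≤ toℕ j
  topX j onX′ with <-cmp (toℕ j) (toℕ k)
  ... | tri< j<k _ _ = ⊥-elim (X≢Y (trans (sym onX′) (belowY j j<k)))
  ... | tri≈ _ j≡k _ = ≤-reflexive (sym j≡k)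
  ... | tri> _ _ k<j = <⇒≤ k<j
  splitY : ∀ j → lookup s j ≡ Y → toℕ j < toℕ k ⊎ toℕ k < toℕ j
  splitY j onY with <-cmp (toℕ j) (toℕ k)
  ... | tri< j<k _ _ = inj₁ j<k
  ... | tri≈ _ j≡k _ = ⊥-elim (X≢Y (trans (sym onX) (trans (cong (lookup s) (toℕ-injective (sym j≡k))) onY)))
  ... | tri> _ _ k<j = inj₂ k<j
  aboveZ : ∀ j → lookup s j ≡ Z → toℕ k < toℕ j
  aboveZ j onZ with <-cmp (toℕ j) (toℕ k)
  ... | tri< j<k _ _ = ⊥-elim (third-≢ʳ X Y (trans (sym onZ) (belowY j j<k)))
  ... | tri≈ _ j≡k _ = ⊥-elim (third-≢ˡ X Y (trans (sym onZ) (trans (cong (lookup s) (toℕ-injective j≡k)) onX)))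
  ... | tri> _ _ k<j = k<j

fromPath : ∀ {n} {s t : State n} (p : Path s t) →
  Σ[ p′ ∈ Path′ (toList s) (toList t) ] length′ p′ ≡ length p × word′ p′ ≡ word p
fromPath done = done , refl , refl
fromPath (step m p) with fromMove m | fromPath p
... | m′ , moveWord≡ | p′ , length≡ , word≡ = step m′ p′ , cong suc length≡ , cong₂ _++_ moveWord≡ word≡

toPath : ∀ {n} (s : State n) {S G} (p′ : Path′ S G) → S ≡ toList s →
  Σ[ g ∈ State n ] toList g ≡ G × Σ[ p ∈ Path s g ] length p ≡ length′ p′
toPath s done S≡ = s , sym S≡ , done , refl
toPath s (step m′ p′) S≡ with toMove s m′ S≡
... | t , t≡ , m with toPath t p′ (sym t≡)
...   | g , g≡ , p , length≡ = g , g≡ , step m p , cong suc length≡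

start-list : ∀ n → toList (start n) ≡ replicate n A ++ replicate 0 C
start-list n = trans (toList-replicate n A) (sym (++-identityʳ _))

goal-list : ∀ n → toList (goal n) ≡ replicate (n + 0) C
goal-list n = trans (toList-replicate n C) (cong (λ k → replicate k C) (sym (+-identityʳ n)))

A≢C : A ≢ C
A≢C ()

goal-from-list : ∀ {n} (g : State n) → toList g ≡ replicate n C ++ [] → g ≡ goal n
goal-from-list {n} g g≡ = trans (sym (cast-is-id refl g))
  (toList-injective refl g (goal n) (trans g≡ (trans (++-identityʳ _) (sym (toList-replicate n C)))))

solution : ∀ n → Σ[ p ∈ Path (start n) (goal n) ] length p ≡ minMoves n
solution n with towerPath n [] A≢C
... | p′ , length′≡ with toPath (start n) p′ (sym (start-list n))
...   | g , g≡ , p , length≡ with goal-from-list g g≡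
...     | refl = p , trans length≡ length′≡

solution-lower : ∀ n (p : Path (start n) (goal n)) → minMoves n ≤ length p
solution-lower n p with fromPath p
... | p′ , length≡ , _ = subst (minMoves n ≤_) length≡ (tower-lower n 0 A≢C p′ (start-list n) (goal-list n))

optimal-solution : ∀ n → Σ (Path (start n) (goal n)) Optimal
optimal-solution n with solution n
... | p , length≡ = p , λ q → ≤-trans (≤-reflexive length≡) (solution-lower n q)

optimal-word : ∀ n (p : Path (start n) (goal n)) → Optimal p → word p ≡ μ n
optimal-word n p optimal with fromPath p | solution n
... | p′ , length′≡ , word′≡ | best , best≡ =
  trans (sym word′≡) (towerWord-unique n 0 A≢C (start-list n) (goal-list n) p′ short)
  where
  short : length′ p′ ≤ minMoves n
  short = begin
    length′ p′  ≡⟨ length′≡ ⟩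
    length p    ≤⟨ optimal best ⟩
    length best ≡⟨ best≡ ⟩
    minMoves n  ∎
    where open ≤-Reasoning

corollary2p6 : Σ (ℕ → List Dir) λ μ →
    ((n : ℕ) → Σ (Path (start n) (goal n)) Optimal)
    × ((n : ℕ) (p : Path (start n) (goal n)) → Optimal p → word p ≡ μ n)
    × μ 0 ≡ []
    × μ 1 ≡ l ∷ []
    × ((n : ℕ) → μ (2 + n) ≡ star (μ (1 + n) ++ μ n))
    × ((n : ℕ) → μ (4 + n) ≡ μ (2 + n) ++ μ (1 + n) ++ μ (1 + n) ++ μ n)
    × ((n : ℕ) → count r (μ (3 * n)) ≡ count l (μ (3 * n)))
    × ((n : ℕ) → count l (μ (3 * n + 1)) ≡ 1 + count r (μ (3 * n + 1)))
    × ((n : ℕ) → count r (μ (3 * n + 2)) ≡ 1 + count l (μ (3 * n + 2)))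
corollary2p6 =
  μ , optimal-solution , optimal-word , refl , refl , (λ n → refl) , μ-four-blocks ,
  proj₁ ∘ count-balance , proj₁ ∘ proj₂ ∘ count-balance , proj₂ ∘ proj₂ ∘ count-balance
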